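{- Let $\pi$ and $\pi_1$ be permutations of $\{1,\dots,n^2\}$ and let $\lambda\in\{ -1,+1\}^{n\cdot s(n)}$ satisfy $A_\pi A_{\pi_1}^T\lambda<>\mathbf{0}$. Then $x=(x_1,\dots,x_{n^2})^T=\frac{1}{2}\bigl(A_{\pi_1}^T\lambda+(n+1)\mathbf{1}_{n^2}\bigr)$ satisfies $x\in\mathbb{Z}^{n^2}$, $1\le x_i\le n$ for $i=1,\dots,n^2$, and $A_\pi x<>\mathbf{0}$.
   Context: Let $n\ge 2$ be an integer and $s(m)=\sum_{i=1}^{m-1} i$. Define matrices $A(m)$ with $s(m)$ rows and $m$ columns recursively: $A(1)$ is the empty matrix, and for $m\ge 2$, $A(m)=\begin{pmatrix}\mathbf{1}_{m-1} & -U_{m-1}\\ \mathbf{0}_{s(m-1)} & A(m-1)\end{pmatrix}$, where $\mathbf{1}_{m-1}$ is the column vector of $m-1$ ones, $U_{m-1}$ is the $(m-1)\times(m-1)$ identity matrix and $\mathbf{0}_{s(m-1)}$ is the zero column vector of length $s(m-1)$ (e.g. $A(2)=(1\;\;-1)$). Let $A$ be the $n\,s(n)\times n^2$ block-diagonal matrix with $n$ copies of $A(n)$ on its diagonal and zeros elsewhere. For a permutation $\pi$ of $\{1,\dots,n^2\}$ let $A_\pi=(a^{\pi^{ -1}(1)},\dots,a^{\pi^{ -1}(n^2)})$, where $a^j$ denotes the $j$-th column of $A$. $\mathbf{1}_m$ is the vector of $m$ ones. For $y\in\mathbb{Z}^s$ write $y<>\mathbf{0}$ if every component of $y$ is nonzero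 (this is stronger than $y\neq\mathbf 0$). -}

module Defs where

open import Data.Nat as ℕ using (ℕ; zero; suc)
open import Data.Integer as ℤ using (ℤ; +_; -_; 0ℤ; 1ℤ)
open import Data.Fin as Fin using (Fin; zero; suc; splitAt; remQuot)
open import Data.Fin.Permutation using (Permutation′; _⟨$⟩ˡ_)
open import Data.Sum using (_⊎_; inj₁; inj₂)
open import Data.Product using (_×_; _,_)
open import Data.Bool using (if_then_else_)
open import Relation.Nullary using (¬_)
open import Relation.Nullary.Decidable using (⌊_⌋)
open import Relation.Binary.PropositionalEquality using (_≡_)

Mat : ℕ → ℕ → Set
Mat r c = Fin r → Fin c → ℤ

Vecℤ : ℕ → Set
Vecℤ k = Fin k → ℤ

Σℤ : ∀ {k} → (Fin k → ℤ) → ℤ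
Σℤ {zero}  f = 0ℤ
Σℤ {suc k} f = f zero ℤ.+ Σℤ (λ i → f (suc i))

s : ℕ → ℕ
s zero    = 0
s (suc m) = m ℕ.+ s m

-- A(m), an s(m) × m matrix, defined by the recursion
-- A(m+1) = ( 1_m  | -U_m ; 0_{s(m)} | A(m) ),  A(1) (and A(0)) empty
Am : (m : ℕ) → Mat (s m) m
Am zero    () j
Am (suc m) r c with splitAt m r
Am (suc m) r zero    | inj₁ i = 1ℤ
Am (suc m) r (suc j) | inj₁ i = if ⌊ i Fin.≟ j ⌋ then - 1ℤ else 0ℤ
Am (suc m) r zero    | inj₂ r' = 0ℤ
Am (suc m) r (suc j) | inj₂ r' = Am m r' j

-- block diagonal matrix with n copies of A(n): (n·s(n)) × n²
-- row  b·s(n)+i  and column  b'·n+j  (via remQuot) carry  A(n)_{i j}  if b = b', else 0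
Ablock : (n : ℕ) → Mat (n ℕ.* s n) (n ℕ.* n)
Ablock n r c with remQuot {n} (s n) r | remQuot {n} n c
... | b , i | b' , j = if ⌊ b Fin.≟ b' ⌋ then Am n i j else 0ℤ

-- A_π : column j is column π⁻¹(j) of A
Aπ : (n : ℕ) → Permutation′ (n ℕ.* n) → Mat (n ℕ.* s n) (n ℕ.* n)
Aπ n π r j = Ablock n r (π ⟨$⟩ˡ j)

_·_ : ∀ {r c} → Mat r c → Vecℤ c → Vecℤ r
(M · v) i = Σℤ (λ j → M i j ℤ.* v j)

_ᵀ·_ : ∀ {r c} → Mat r c → Vecℤ r → Vecℤ c
(M ᵀ· v) j = Σℤ (λ i → M i j ℤ.* v i)

_<>0 : ∀ {k} → Vecℤ k → Set
y <>0 = ∀ i → ¬ (y i ≡ 0ℤ)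

IsSignVec : ∀ {k} → Vecℤ k → Set
IsSignVec v = ∀ i → (v i ≡ 1ℤ) ⊎ (v i ≡ - 1ℤ)

-- Every column of A(n) has exactly n − 1 nonzero entries, all equal to ±1: the first column
-- consists of the ones of the top block, and column j + 1 has the single −1 of −U together with
-- column j of A(n − 1).  So every entry of A_{π₁}ᵀ λ is a sum of n − 1 signs, which has the
-- parity of n − 1 and lies in [−(n − 1), n − 1]; this makes x integral with 1 ≤ xᵢ ≤ n.
-- Every row of A(n), hence of A_π, sums to zero, so A_π 𝟏 = 0 and 2 A_π x = A_π A_{π₁}ᵀ λ,
-- whose entries are nonzero.
module Submission where

open import Defs
open import Data.Nat as ℕ using (ℕ; _≤_; zero; suc; z≤n; s≤s)
open import Data.Nat.Properties using (m≤n⇒m≤1+n)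
open import Data.Integer as ℤ using (ℤ; +_; -_; 0ℤ; 1ℤ; _+_; _*_; +≤+)
import Data.Integer.Properties as ℤP
open import Data.Integer.Solver using (module +-*-Solver)
open import Data.Fin as Fin using (Fin; zero; suc; splitAt; remQuot; combine; punchIn; _↑ˡ_; _↑ʳ_)
open import Data.Fin.Properties using (splitAt-↑ˡ; splitAt-↑ʳ; remQuot-combine; combine-remQuot; punchInᵢ≢i)
open import Data.Fin.Permutation using (Permutation′; _⟨$⟩ˡ_; flip)
open import Data.Product using (_×_; Σ; ∃-syntax; _,_; proj₁; proj₂)
open import Data.Sum using (_⊎_; inj₁; inj₂)
open import Data.Bool using (Bool; true; false; if_then_else_)
open import Function using (_∘_)
open import Relation.Nullary.Decidable using (⌊_⌋; dec-yes-recompute; dec-no)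
open import Relation.Binary.PropositionalEquality
open import Algebra.Properties.Semiring.Sum ℤP.+-*-semiring
  using (sum; sum-cong-≗; sum-replicate-zero; sum-remove; sum-permute; ∑-distrib-+; *-distribˡ-sum)
open import Algebra.Properties.CommutativeSemigroup ℤP.*-commutativeSemigroup using (x∙yz≈y∙xz)

open +-*-Solver using (solve; _:=_; _:+_; _:*_; con)
open ≡-Reasoning

Σℤ≡sum : ∀ {k} (f : Fin k → ℤ) → Σℤ f ≡ sum f
Σℤ≡sum {zero}  f = refl
Σℤ≡sum {suc k} f = cong (_+_ (f zero)) (Σℤ≡sum (f ∘ suc))

Σℤ-cong : ∀ {k} {f g : Fin k → ℤ} → (∀ i → f i ≡ g i) → Σℤ f ≡ Σℤ g
Σℤ-cong {f = f} {g} f≗g = trans (Σℤ≡sum f) (trans (sum-cong-≗ f≗g) (sym (Σℤ≡sum g)))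

Σℤ-zero : ∀ {k} {f : Fin k → ℤ} → (∀ i → f i ≡ 0ℤ) → Σℤ f ≡ 0ℤ
Σℤ-zero {k} f≗0 = trans (Σℤ-cong f≗0) (trans (Σℤ≡sum {k} (λ _ → 0ℤ)) (sum-replicate-zero k))

Σℤ-distrib-+ : ∀ {k} (f g : Fin k → ℤ) → Σℤ (λ i → f i + g i) ≡ Σℤ f + Σℤ g
Σℤ-distrib-+ f g = begin
  Σℤ (λ i → f i + g i)  ≡⟨ Σℤ≡sum (λ i → f i + g i) ⟩
  sum (λ i → f i + g i) ≡⟨ ∑-distrib-+ f g ⟩
  sum f + sum g         ≡⟨ sym (cong₂ _+_ (Σℤ≡sum f) (Σℤ≡sum g)) ⟩
  Σℤ f + Σℤ g           ∎

Σℤ-*ˡ : ∀ {k} (c : ℤ) (f : Fin k → ℤ) → Σℤ (λ i → c * f i) ≡ c * Σℤ f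
Σℤ-*ˡ c f = begin
  Σℤ (λ i → c * f i)  ≡⟨ Σℤ≡sum (λ i → c * f i) ⟩
  sum (λ i → c * f i) ≡⟨ sym (*-distribˡ-sum c f) ⟩
  c * sum f           ≡⟨ sym (cong (c *_) (Σℤ≡sum f)) ⟩
  c * Σℤ f            ∎

Σℤ-single : ∀ {k} (f : Fin k → ℤ) (i : Fin k) → (∀ j → j ≢ i → f j ≡ 0ℤ) → Σℤ f ≡ f i
Σℤ-single {suc k} f i off = begin
  Σℤ f                         ≡⟨ Σℤ≡sum f ⟩
  sum f                        ≡⟨ sum-remove f ⟩
  f i + sum (f ∘ punchIn i)    ≡⟨ cong (_+_ (f i)) (sym (Σℤ≡sum (f ∘ punchIn i))) ⟩
  f i + Σℤ (f ∘ punchIn i)     ≡⟨ cong (_+_ (f i)) (Σℤ-zero (λ j → off (punchIn i j) (punchInᵢ≢i i j))) ⟩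
  f i + 0ℤ                     ≡⟨ ℤP.+-identityʳ (f i) ⟩
  f i                          ∎

Σℤ-permute : ∀ {k} (π : Permutation′ k) (f : Fin k → ℤ) → Σℤ (f ∘ (π ⟨$⟩ˡ_)) ≡ Σℤ f
Σℤ-permute π f = begin
  Σℤ (f ∘ (π ⟨$⟩ˡ_))  ≡⟨ Σℤ≡sum (f ∘ (π ⟨$⟩ˡ_)) ⟩
  sum (f ∘ (π ⟨$⟩ˡ_)) ≡⟨ sym (sum-permute f (flip π)) ⟩
  sum f               ≡⟨ sym (Σℤ≡sum f) ⟩
  Σℤ f                ∎

Σℤ-splitAt : ∀ m {k} (f : Fin (m ℕ.+ k) → ℤ) → Σℤ f ≡ Σℤ (f ∘ (_↑ˡ k)) + Σℤ (f ∘ (m ↑ʳ_))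
Σℤ-splitAt zero    f = sym (ℤP.+-identityˡ (Σℤ f))
Σℤ-splitAt (suc m) f = trans (cong (_+_ (f zero)) (Σℤ-splitAt m (f ∘ suc))) (sym (ℤP.+-assoc (f zero) _ _))

Σℤ-combine : ∀ n k (f : Fin (n ℕ.* k) → ℤ) → Σℤ f ≡ Σℤ {n} (λ b → Σℤ {k} (f ∘ combine b))
Σℤ-combine zero    k f = refl
Σℤ-combine (suc n) k f = trans (Σℤ-splitAt k f) (cong (_+_ (Σℤ (f ∘ (_↑ˡ n ℕ.* k)))) (Σℤ-combine n k (f ∘ (k ↑ʳ_))))

if-*ʳ : ∀ (c : Bool) x y → (if c then x else 0ℤ) * y ≡ (if c then x * y else 0ℤ)
if-*ʳ true  x y = refl
if-*ʳ false x y = ℤP.*-zeroˡ y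

Σℤ-if : ∀ {k} (c : Bool) (f : Fin k → ℤ) → Σℤ (λ i → if c then f i else 0ℤ) ≡ (if c then Σℤ f else 0ℤ)
Σℤ-if true  f = refl
Σℤ-if {k} false f = Σℤ-zero {k} (λ _ → refl)

Σℤ-if-≟ˡ : ∀ {k} (j : Fin k) (f : Fin k → ℤ) → Σℤ (λ i → if ⌊ i Fin.≟ j ⌋ then f i else 0ℤ) ≡ f j
Σℤ-if-≟ˡ j f = trans (Σℤ-single _ j off) on-j
  where
  off : ∀ i → i ≢ j → (if ⌊ i Fin.≟ j ⌋ then f i else 0ℤ) ≡ 0ℤ
  off i i≢j rewrite dec-no (i Fin.≟ j) i≢j = refl
  on-j : (if ⌊ j Fin.≟ j ⌋ then f j else 0ℤ) ≡ f j
  on-j rewrite dec-yes-recompute (j Fin.≟ j) refl = refl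

Σℤ-if-≟ʳ : ∀ {k} (i : Fin k) (f : Fin k → ℤ) → Σℤ (λ j → if ⌊ i Fin.≟ j ⌋ then f j else 0ℤ) ≡ f i
Σℤ-if-≟ʳ i f = trans (Σℤ-single _ i off) on-i
  where
  off : ∀ j → j ≢ i → (if ⌊ i Fin.≟ j ⌋ then f j else 0ℤ) ≡ 0ℤ
  off j j≢i rewrite dec-no (i Fin.≟ j) (j≢i ∘ sym) = refl
  on-i : (if ⌊ i Fin.≟ i ⌋ then f i else 0ℤ) ≡ f i
  on-i rewrite dec-yes-recompute (i Fin.≟ i) refl = refl

·-*ˡ : ∀ {r c} (M : Mat r c) (k : ℤ) (v : Vecℤ c) i → (M · (λ j → k * v j)) i ≡ k * (M · v) i
·-*ˡ M k v i = trans (Σℤ-cong (λ j → x∙yz≈y∙xz (M i j) k (v j))) (Σℤ-*ˡ k (λ j → M i j * v j))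

·-+-const : ∀ {r c} (M : Mat r c) → (∀ i → Σℤ (M i) ≡ 0ℤ) →
            ∀ (v : Vecℤ c) k i → (M · (λ j → v j + k)) i ≡ (M · v) i
·-+-const M rowSum≡0 v k i = begin
  Σℤ (λ j → M i j * (v j + k))           ≡⟨ Σℤ-cong (λ j → ℤP.*-distribˡ-+ (M i j) (v j) k) ⟩
  Σℤ (λ j → M i j * v j + M i j * k)     ≡⟨ Σℤ-distrib-+ (λ j → M i j * v j) (λ j → M i j * k) ⟩
  (M · v) i + Σℤ (λ j → M i j * k)       ≡⟨ cong (_+_ ((M · v) i)) (Σℤ-cong (λ j → ℤP.*-comm (M i j) k)) ⟩
  (M · v) i + Σℤ (λ j → k * M i j)       ≡⟨ cong (_+_ ((M · v) i)) (Σℤ-*ˡ k (M i)) ⟩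
  (M · v) i + k * Σℤ (M i)               ≡⟨ cong (λ t → (M · v) i + k * t) (rowSum≡0 i) ⟩
  (M · v) i + k * 0ℤ                     ≡⟨ cong (_+_ ((M · v) i)) (ℤP.*-zeroʳ k) ⟩
  (M · v) i + 0ℤ                         ≡⟨ ℤP.+-identityʳ _ ⟩
  (M · v) i                              ∎

IsSign : ℤ → Set
IsSign v = (v ≡ 1ℤ) ⊎ (v ≡ - 1ℤ)

IsSign-neg : ∀ {v} → IsSign v → IsSign (- 1ℤ * v)
IsSign-neg (inj₁ refl) = inj₂ refl
IsSign-neg (inj₂ refl) = inj₁ refl

data SignSum : ℕ → ℤ → Set where
  []  : SignSum 0 0ℤ
  _∷_ : ∀ {m e a} → IsSign e → SignSum m a → SignSum (suc m) (e + a)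

signSum-Σℤ : ∀ {k} {g : Fin k → ℤ} → IsSignVec g → SignSum k (Σℤ g)
signSum-Σℤ {zero}  _  = []
signSum-Σℤ {suc k} sg = sg zero ∷ signSum-Σℤ (sg ∘ suc)

signSum-+0 : ∀ {m a} → SignSum m a → SignSum m (a + 0ℤ)
signSum-+0 {m} {a} = subst (SignSum m) (sym (ℤP.+-identityʳ a))

-- a = 2u − m, where u counts the signs equal to +1
signSum-half : ∀ {m a} → SignSum m a → ∃[ u ] u ≤ m × + 2 * + suc u ≡ a + + (suc m ℕ.+ 1)
signSum-half [] = 0 , z≤n , refl
signSum-half (_∷_ {m} {a = a} (inj₁ refl) ss) with signSum-half ss
... | u , u≤m , 2[1+u]≡a+N = suc u , s≤s u≤m , (begin
  + 2 * (1ℤ + + suc u)     ≡⟨ solve 1 (λ U → con (+ 2) :* (con 1ℤ :+ U) := con (+ 2) :* U :+ con (+ 2)) refl (+ suc u) ⟩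
  + 2 * + suc u + + 2      ≡⟨ cong (_+ + 2) 2[1+u]≡a+N ⟩
  a + N + + 2              ≡⟨ solve 2 (λ A N → A :+ N :+ con (+ 2) := (con 1ℤ :+ A) :+ (con 1ℤ :+ N)) refl a N ⟩
  (1ℤ + a) + (1ℤ + N)      ∎)
  where N = + (suc m ℕ.+ 1)
signSum-half (_∷_ {m} {a = a} (inj₂ refl) ss) with signSum-half ss
... | u , u≤m , 2[1+u]≡a+N = u , m≤n⇒m≤1+n u≤m , (begin
  + 2 * + suc u            ≡⟨ 2[1+u]≡a+N ⟩
  a + N                    ≡⟨ solve 2 (λ A N → A :+ N := (con (- 1ℤ) :+ A) :+ (con 1ℤ :+ N)) refl a N ⟩
  (- 1ℤ + a) + (1ℤ + N)    ∎)
  where N = + (suc m ℕ.+ 1)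

Am-↑ˡ-zero : ∀ m (i : Fin m) → Am (suc m) (i ↑ˡ s m) zero ≡ 1ℤ
Am-↑ˡ-zero m i rewrite splitAt-↑ˡ m i (s m) = refl

Am-↑ˡ-suc : ∀ m (i j : Fin m) → Am (suc m) (i ↑ˡ s m) (suc j) ≡ (if ⌊ i Fin.≟ j ⌋ then - 1ℤ else 0ℤ)
Am-↑ˡ-suc m i j rewrite splitAt-↑ˡ m i (s m) = refl

Am-↑ʳ-zero : ∀ m (r : Fin (s m)) → Am (suc m) (m ↑ʳ r) zero ≡ 0ℤ
Am-↑ʳ-zero m r rewrite splitAt-↑ʳ m (s m) r = refl

Am-↑ʳ-suc : ∀ m (r : Fin (s m)) (j : Fin m) → Am (suc m) (m ↑ʳ r) (suc j) ≡ Am m r j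
Am-↑ʳ-suc m r j rewrite splitAt-↑ʳ m (s m) r = refl

Am-row-sum : ∀ m (r : Fin (s m)) → Σℤ (Am m r) ≡ 0ℤ
Am-row-sum (suc m) r with splitAt m r
... | inj₁ i  = cong (_+_ 1ℤ) (Σℤ-if-≟ʳ i (λ _ → - 1ℤ))
... | inj₂ r′ = trans (ℤP.+-identityˡ _) (Am-row-sum m r′)

Am-column-signSum : ∀ m (j : Fin (suc m)) {μ : Vecℤ (s (suc m))} → IsSignVec μ →
                    SignSum m ((Am (suc m) ᵀ· μ) j)
Am-column-signSum m zero {μ} sg =
  subst (SignSum m) (sym first-column) (signSum-+0 (signSum-Σℤ (sg ∘ (_↑ˡ s m))))
  where
  first-column : (Am (suc m) ᵀ· μ) zero ≡ Σℤ (μ ∘ (_↑ˡ s m)) + 0ℤ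
  first-column = begin
    Σℤ (λ r → Am (suc m) r zero * μ r)
      ≡⟨ Σℤ-splitAt m {s m} (λ r → Am (suc m) r zero * μ r) ⟩
    Σℤ {m} (λ i → Am (suc m) (i ↑ˡ s m) zero * μ (i ↑ˡ s m)) + Σℤ (λ r → Am (suc m) (m ↑ʳ r) zero * μ (m ↑ʳ r))
      ≡⟨ cong₂ _+_ (Σℤ-cong top) (Σℤ-zero bottom) ⟩
    Σℤ (μ ∘ (_↑ˡ s m)) + 0ℤ
      ∎
    where
    top : ∀ (i : Fin m) → Am (suc m) (i ↑ˡ s m) zero * μ (i ↑ˡ s m) ≡ μ (i ↑ˡ s m)
    top i = trans (cong (_* μ (i ↑ˡ s m)) (Am-↑ˡ-zero m i)) (ℤP.*-identityˡ _)
    bottom : ∀ r → Am (suc m) (m ↑ʳ r) zero * μ (m ↑ʳ r) ≡ 0ℤ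
    bottom r = cong (_* μ (m ↑ʳ r)) (Am-↑ʳ-zero m r)
Am-column-signSum (suc m) (suc j) {μ} sg =
  subst (SignSum (suc m)) (sym later-column)
        (IsSign-neg (sg (j ↑ˡ s (suc m))) ∷ Am-column-signSum m j (sg ∘ (suc m ↑ʳ_)))
  where
  later-column : (Am (suc (suc m)) ᵀ· μ) (suc j)
               ≡ - 1ℤ * μ (j ↑ˡ s (suc m)) + (Am (suc m) ᵀ· (μ ∘ (suc m ↑ʳ_))) j
  later-column = begin
    Σℤ (λ r → Am (suc (suc m)) r (suc j) * μ r)
      ≡⟨ Σℤ-splitAt (suc m) {s (suc m)} (λ r → Am (suc (suc m)) r (suc j) * μ r) ⟩
    Σℤ {suc m} (λ i → Am (suc (suc m)) (i ↑ˡ s (suc m)) (suc j) * μ (i ↑ˡ s (suc m)))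
      + Σℤ (λ r → Am (suc (suc m)) (suc m ↑ʳ r) (suc j) * μ (suc m ↑ʳ r))
      ≡⟨ cong₂ _+_ (Σℤ-cong top) (Σℤ-cong bottom) ⟩
    Σℤ {suc m} (λ i → if ⌊ i Fin.≟ j ⌋ then - 1ℤ * μ (i ↑ˡ s (suc m)) else 0ℤ)
      + (Am (suc m) ᵀ· (μ ∘ (suc m ↑ʳ_))) j
      ≡⟨ cong (_+ (Am (suc m) ᵀ· (μ ∘ (suc m ↑ʳ_))) j) (Σℤ-if-≟ˡ j (λ i → - 1ℤ * μ (i ↑ˡ s (suc m)))) ⟩
    - 1ℤ * μ (j ↑ˡ s (suc m)) + (Am (suc m) ᵀ· (μ ∘ (suc m ↑ʳ_))) j
      ∎
    where
    top : ∀ (i : Fin (suc m)) → Am (suc (suc m)) (i ↑ˡ s (suc m)) (suc j) * μ (i ↑ˡ s (suc m))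
              ≡ (if ⌊ i Fin.≟ j ⌋ then - 1ℤ * μ (i ↑ˡ s (suc m)) else 0ℤ)
    top i = trans (cong (_* μ (i ↑ˡ s (suc m))) (Am-↑ˡ-suc (suc m) i j)) (if-*ʳ ⌊ i Fin.≟ j ⌋ (- 1ℤ) _)
    bottom : ∀ r → Am (suc (suc m)) (suc m ↑ʳ r) (suc j) * μ (suc m ↑ʳ r) ≡ Am (suc m) r j * μ (suc m ↑ʳ r)
    bottom r = cong (_* μ (suc m ↑ʳ r)) (Am-↑ʳ-suc (suc m) r j)

Ablock-combine : ∀ n (b : Fin n) (i : Fin (s n)) (b′ : Fin n) (j : Fin n) →
                 Ablock n (combine b i) (combine b′ j) ≡ (if ⌊ b Fin.≟ b′ ⌋ then Am n i j else 0ℤ)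
Ablock-combine n b i b′ j = cong₂ entry (remQuot-combine {n} {s n} b i) (remQuot-combine {n} {n} b′ j)
  where
  entry : Fin n × Fin (s n) → Fin n × Fin n → ℤ
  entry (b , i) (b′ , j) = if ⌊ b Fin.≟ b′ ⌋ then Am n i j else 0ℤ

Ablock-row-sum : ∀ n (r : Fin (n ℕ.* s n)) → Σℤ (Ablock n r) ≡ 0ℤ
Ablock-row-sum n r = subst (λ r → Σℤ (Ablock n r) ≡ 0ℤ) (combine-remQuot {n} (s n) r) (begin
  Σℤ (Ablock n (combine b i))                                              ≡⟨ Σℤ-combine n n (Ablock n (combine b i)) ⟩
  Σℤ {n} (λ b′ → Σℤ {n} (λ j → Ablock n (combine b i) (combine b′ j)))             ≡⟨ Σℤ-cong (λ b′ → Σℤ-cong (Ablock-combine n b i b′)) ⟩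
  Σℤ (λ b′ → Σℤ (λ j → if ⌊ b Fin.≟ b′ ⌋ then Am n i j else 0ℤ))           ≡⟨ Σℤ-cong (λ b′ → Σℤ-if ⌊ b Fin.≟ b′ ⌋ (Am n i)) ⟩
  Σℤ (λ b′ → if ⌊ b Fin.≟ b′ ⌋ then Σℤ (Am n i) else 0ℤ)                   ≡⟨ Σℤ-if-≟ʳ b (λ _ → Σℤ (Am n i)) ⟩
  Σℤ (Am n i)                                                              ≡⟨ Am-row-sum n i ⟩
  0ℤ                                                                       ∎)
  where
  b = proj₁ (remQuot {n} (s n) r)
  i = proj₂ (remQuot {n} (s n) r)

Ablock-column : ∀ n (μ : Vecℤ (n ℕ.* s n)) (b′ : Fin n) (j : Fin n) →
                (Ablock n ᵀ· μ) (combine b′ j) ≡ (Am n ᵀ· (μ ∘ combine b′)) j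
Ablock-column n μ b′ j = begin
  (Ablock n ᵀ· μ) (combine b′ j)                                                          ≡⟨ Σℤ-combine n (s n) (λ r → Ablock n r (combine b′ j) * μ r) ⟩
  Σℤ {n} (λ b → Σℤ {s n} (λ i → Ablock n (combine b i) (combine b′ j) * μ (combine b i)))           ≡⟨ Σℤ-cong (λ b → Σℤ-cong (λ i → entry b i)) ⟩
  Σℤ (λ b → Σℤ (λ i → if ⌊ b Fin.≟ b′ ⌋ then Am n i j * μ (combine b i) else 0ℤ))         ≡⟨ Σℤ-cong (λ b → Σℤ-if ⌊ b Fin.≟ b′ ⌋ (λ i → Am n i j * μ (combine b i))) ⟩
  Σℤ (λ b → if ⌊ b Fin.≟ b′ ⌋ then Σℤ (λ i → Am n i j * μ (combine b i)) else 0ℤ)         ≡⟨ Σℤ-if-≟ˡ b′ (λ b → Σℤ (λ i → Am n i j * μ (combine b i))) ⟩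
  (Am n ᵀ· (μ ∘ combine b′)) j                                                            ∎
  where
  entry : ∀ b i → Ablock n (combine b i) (combine b′ j) * μ (combine b i)
                ≡ (if ⌊ b Fin.≟ b′ ⌋ then Am n i j * μ (combine b i) else 0ℤ)
  entry b i = trans (cong (_* μ (combine b i)) (Ablock-combine n b i b′ j)) (if-*ʳ ⌊ b Fin.≟ b′ ⌋ (Am n i j) _)

Ablock-column-signSum : ∀ m (c : Fin (suc m ℕ.* suc m)) {μ : Vecℤ (suc m ℕ.* s (suc m))} → IsSignVec μ →
                        SignSum m ((Ablock (suc m) ᵀ· μ) c)
Ablock-column-signSum m c {μ} sg =
  subst (λ c → SignSum m ((Ablock n ᵀ· μ) c)) (combine-remQuot {n} n c)
        (subst (SignSum m) (sym (Ablock-column n μ b′ j)) (Am-column-signSum m j (sg ∘ combine b′)))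
  where
  n = suc m
  b′ = proj₁ (remQuot {n} n c)
  j = proj₂ (remQuot {n} n c)

Aπ-row-sum : ∀ n (π : Permutation′ (n ℕ.* n)) (r : Fin (n ℕ.* s n)) → Σℤ (Aπ n π r) ≡ 0ℤ
Aπ-row-sum n π r = trans (Σℤ-permute π (Ablock n r)) (Ablock-row-sum n r)

lemma3p3 : (n : ℕ) → 2 ≤ n → (π π₁ : Permutation′ (n ℕ.* n)) → (lam : Vecℤ (n ℕ.* s n)) → IsSignVec lam → (Aπ n π · (Aπ n π₁ ᵀ· lam)) <>0 → Σ (Vecℤ (n ℕ.* n)) (λ x → (∀ i → (+ 2) ℤ.* x i ≡ (Aπ n π₁ ᵀ· lam) i ℤ.+ (+ (n ℕ.+ 1))) × (∀ i → (+ 1 ℤ.≤ x i) × (x i ℤ.≤ + n)) × ((Aπ n π · x) <>0))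
lemma3p3 (suc m) _ π π₁ lam sg Ay<>0 = x , 2x≡y+[n+1] , bounds , Ax<>0
  where
  n = suc m
  y = Aπ n π₁ ᵀ· lam
  half : ∀ j → ∃[ u ] u ≤ m × + 2 * + suc u ≡ y j + + (n ℕ.+ 1)
  half j = signSum-half (Ablock-column-signSum m (π₁ ⟨$⟩ˡ j) sg)
  x : Vecℤ (n ℕ.* n)
  x j = + suc (proj₁ (half j))
  2x≡y+[n+1] : ∀ j → + 2 * x j ≡ y j + + (n ℕ.+ 1)
  2x≡y+[n+1] j = proj₂ (proj₂ (half j))
  bounds : ∀ j → (+ 1 ℤ.≤ x j) × (x j ℤ.≤ + n)
  bounds j = +≤+ (s≤s z≤n) , +≤+ (s≤s (proj₁ (proj₂ (half j))))
  Ax<>0 : (Aπ n π · x) <>0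
  Ax<>0 r Ax≡0 = Ay<>0 r (begin
    (Aπ n π · y) r                             ≡⟨ sym (·-+-const (Aπ n π) (Aπ-row-sum n π) y _ r) ⟩
    (Aπ n π · (λ j → y j + + (n ℕ.+ 1))) r     ≡⟨ Σℤ-cong (λ j → cong (Aπ n π r j *_) (sym (2x≡y+[n+1] j))) ⟩
    (Aπ n π · (λ j → + 2 * x j)) r             ≡⟨ ·-*ˡ (Aπ n π) (+ 2) x r ⟩
    + 2 * (Aπ n π · x) r                       ≡⟨ cong (+ 2 *_) Ax≡0 ⟩
    0ℤ                                         ∎)
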